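{- Let $q$ be a prime power, $\mathrm{PG}(3,q)=\mathrm{AG}(3,q)\cup H_\infty$, and let $U\subset\mathrm{AG}(3,q)$ with $|U|=q^2$, $U$ not contained in a plane. Suppose more than two lines of $H_\infty$ are not determined by $U$, let $\ell_1$ be one of them, and suppose there exist two distinct parallel affine lines $f,g$ contained in $U$ whose ideal point lies on $\ell_1$. Then all lines of $H_\infty$ not determined by $U$ pass through a common point, namely the ideal point of $f$ and $g$.
   Context: A line $\ell\subset H_\infty$ is determined by $U$ if some affine plane whose line at infinity is $\ell$ contains three non-collinear points of $U$. The ideal point of an affine line is its point at infinity. -}

module Defs where

open import Level using (0ℓ)
open import Data.Nat using (ℕ)
open import Data.Fin using (Fin)
open import Data.Product using (Σ; ∃; _×_; _,_)
open import Data.List using (List; length)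
open import Data.List.Membership.Propositional using (_∈_)
open import Relation.Binary.PropositionalEquality using (_≡_)
open import Relation.Nullary using (¬_; Dec)
open import Function.Bundles using (_↔_)
open import Algebra.Structures using (IsCommutativeRing)

-- A finite field with exactly q elements (equality is propositional).
-- Every such field is GF(q); its existence forces q to be a prime power.
record FiniteField (q : ℕ) : Set₁ where
  infixl 6 _+_
  infixl 7 _*_
  field
    Carrier  : Set
    _+_ _*_  : Carrier → Carrier → Carrier
    -_       : Carrier → Carrier
    0# 1#    : Carrier
    isCommutativeRing : IsCommutativeRing _≡_ _+_ _*_ -_ 0# 1#
    0≢1      : ¬ (0# ≡ 1#)
    inverse  : ∀ x → ¬ (x ≡ 0#) → Σ Carrier λ y → x * y ≡ 1#
    _≟_      : (x y : Carrier) → Dec (x ≡ y)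
    enum     : Fin q ↔ Carrier

module Geometry {q : ℕ} (F : FiniteField q) where
  open FiniteField F

  -- Points of AG(3,q) = F³ (also used for direction / normal vectors).
  record Pt : Set where
    constructor ⟨_,_,_⟩
    field x₁ x₂ x₃ : Carrier
  open Pt public

  _⊕_ : Pt → Pt → Pt
  ⟨ a , b , c ⟩ ⊕ ⟨ d , e , f ⟩ = ⟨ a + d , b + e , c + f ⟩

  _⊖_ : Pt → Pt → Pt
  ⟨ a , b , c ⟩ ⊖ ⟨ d , e , f ⟩ = ⟨ a + (- d) , b + (- e) , c + (- f) ⟩

  _·_ : Carrier → Pt → Pt
  t · ⟨ a , b , c ⟩ = ⟨ t * a , t * b , t * c ⟩

  _∙_ : Pt → Pt → Carrier
  ⟨ a , b , c ⟩ ∙ ⟨ d , e , f ⟩ = a * d + b * e + c * f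

  _×ᵥ_ : Pt → Pt → Pt
  ⟨ a , b , c ⟩ ×ᵥ ⟨ d , e , f ⟩ =
    ⟨ b * f + (- (c * e)) , c * d + (- (a * f)) , a * e + (- (b * d)) ⟩

  𝟎 : Pt
  𝟎 = ⟨ 0# , 0# , 0# ⟩

  NonZero : Pt → Set
  NonZero v = ¬ (v ≡ 𝟎)

  -- Points at infinity = directions (nonzero vectors up to scalars).
  -- Lines of H∞ are represented by a nonzero normal vector n (up to scalars):
  -- the line at infinity with normal n consists of the directions d with n ∙ d ≡ 0,
  -- and the affine planes having it as line at infinity are {x ∣ n ∙ x ≡ c}.
  -- Two normals give the same line of H∞ iff they are proportional,
  -- i.e. iff their cross product vanishes.
  DistinctLines : Pt → Pt → Set
  DistinctLines n m = NonZero (n ×ᵥ m)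

  OnLineAtInfinity : Pt → Pt → Set
  OnLineAtInfinity d n = n ∙ d ≡ 0#

  Collinear : Pt → Pt → Pt → Set
  Collinear a b c = (b ⊖ a) ×ᵥ (c ⊖ a) ≡ 𝟎

  InPlane : Pt → Carrier → Pt → Set
  InPlane n c x = n ∙ x ≡ c

  Determined : List Pt → Pt → Set
  Determined U n = Σ Carrier λ c → Σ Pt λ a → Σ Pt λ b → Σ Pt λ e →
    (a ∈ U × b ∈ U × e ∈ U) ×
    (InPlane n c a × InPlane n c b × InPlane n c e) ×
    ¬ Collinear a b e

  InSomePlane : List Pt → Set
  InSomePlane U = Σ Pt λ n → Σ Carrier λ c → NonZero n × (∀ x → x ∈ U → InPlane n c x)

  LineIn : Pt → Pt → List Pt → Set
  LineIn p d U = ∀ t → (p ⊕ (t · d)) ∈ U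

  OnAffineLine : Pt → Pt → Pt → Set
  OnAffineLine p d x = Σ Carrier λ t → x ≡ p ⊕ (t · d)

-- Indeed, suppose n ∙ d ≠ 0.  For y ∈ U the plane {x ∣ n ∙ x = n ∙ y} meets f
-- and g in points A, B of U; as n is not determined, A, B, y are collinear.
-- The triple-product identity  d ∙ ((B − A) × (y − A)) = N ∙ (y − p),  with
-- N = d × (r − p), then puts y in the plane spanned by f and g.  Since
-- r ∉ f, the normal N is nonzero, so U lies in a plane: contradiction.

module Submission where

open import Algebra.Bundles using (CommutativeRing)
open import Algebra.Solver.Ring.AlmostCommutativeRing
  using (_-Raw-AlmostCommutative⟶_; fromCommutativeRing)
import Algebra.Properties.Ring as RingProperties
import Algebra.Properties.AbelianGroup as AbelianGroupProperties
import Algebra.Properties.Semiring.Mult as SemiringMult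
open import Data.Empty using (⊥-elim)
open import Data.Integer as ℤ using (ℤ; -[1+_]; _◃_)
import Data.Integer.Properties as ℤₚ
open import Data.List using (List; length)
open import Data.List.Membership.Propositional using (_∈_)
open import Data.List.Relation.Unary.Unique.Propositional using (Unique)
open import Data.Maybe.Base using (Maybe; just; nothing)
open import Data.Nat as ℕ using (ℕ; zero; suc)
import Data.Nat.Properties as ℕₚ
open import Data.Product using (Σ; _,_; _×_)
import Data.Sign.Base as Sign
open import Relation.Binary.PropositionalEquality as ≡ using (_≡_)
open import Relation.Nullary using (¬_; Dec; yes; no)

open import Defs

-- Every commutative ring admits the ring solver with coefficients in ℤ:
-- ℤ maps homomorphically into the ring and equality of integers is
-- decidable, so two polynomial expressions can be compared by normalising.
module IntegerCoefficientSolver {c ℓ} (R : CommutativeRing c ℓ) where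

  private
    open CommutativeRing R
      using ( Carrier; _≈_; _+_; _*_; -_; 0#; 1#; refl; sym; trans; setoid
            ; +-congˡ; +-congʳ; -‿cong; +-assoc; +-comm; +-identityˡ; +-identityʳ
            ; -‿inverseʳ; ring; semiring; +-abelianGroup )
    open RingProperties ring using (-‿distribˡ-*; -‿distribʳ-*; -0#≈0#; -‿involutive)
    open AbelianGroupProperties +-abelianGroup using (⁻¹-∙-comm)
    open SemiringMult semiring using (×-homo-+; ×1-homo-*) renaming (_×_ to _×ᵣ_)
    open import Relation.Binary.Reasoning.Setoid setoid

    ⟦_⟧ℤ : ℤ → Carrier
    ⟦ ℤ.+ n ⟧ℤ = n ×ᵣ 1#
    ⟦ -[1+ n ] ⟧ℤ = - (suc n ×ᵣ 1#)

    neg-homo : ∀ i → ⟦ ℤ.- i ⟧ℤ ≈ - ⟦ i ⟧ℤ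
    neg-homo (ℤ.+ zero) = sym -0#≈0#
    neg-homo (ℤ.+ suc n) = refl
    neg-homo -[1+ n ] = sym (-‿involutive _)

    cancel-1# : ∀ x y → (1# + x) + - (1# + y) ≈ x + - y
    cancel-1# x y = begin
      (1# + x) + - (1# + y)   ≈⟨ +-congˡ (⁻¹-∙-comm 1# y) ⟨
      (1# + x) + (- 1# + - y) ≈⟨ +-assoc 1# x _ ⟩
      1# + (x + (- 1# + - y)) ≈⟨ +-congˡ (+-assoc x _ _) ⟨
      1# + ((x + - 1#) + - y) ≈⟨ +-congˡ (+-congʳ (+-comm x _)) ⟩
      1# + ((- 1# + x) + - y) ≈⟨ +-congˡ (+-assoc _ x _) ⟩
      1# + (- 1# + (x + - y)) ≈⟨ +-assoc 1# _ _ ⟨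
      (1# + - 1#) + (x + - y) ≈⟨ +-congʳ (-‿inverseʳ 1#) ⟩
      0# + (x + - y)          ≈⟨ +-identityˡ _ ⟩
      x + - y                 ∎

    ⊖-homo : ∀ m n → ⟦ m ℤ.⊖ n ⟧ℤ ≈ m ×ᵣ 1# + - (n ×ᵣ 1#)
    ⊖-homo m zero = begin
      ⟦ m ℤ.⊖ zero ⟧ℤ ≡⟨ ≡.cong ⟦_⟧ℤ (ℤₚ.⊖-≥ {m} {0} ℕ.z≤n) ⟩
      m ×ᵣ 1#         ≈⟨ +-identityʳ _ ⟨
      m ×ᵣ 1# + 0#    ≈⟨ +-congˡ -0#≈0# ⟨
      m ×ᵣ 1# + - 0#  ∎
    ⊖-homo zero (suc n) = sym (+-identityˡ _)
    ⊖-homo (suc m) (suc n) = begin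
      ⟦ suc m ℤ.⊖ suc n ⟧ℤ            ≡⟨ ≡.cong ⟦_⟧ℤ (ℤₚ.[1+m]⊖[1+n]≡m⊖n m n) ⟩
      ⟦ m ℤ.⊖ n ⟧ℤ                    ≈⟨ ⊖-homo m n ⟩
      m ×ᵣ 1# + - (n ×ᵣ 1#)           ≈⟨ cancel-1# _ _ ⟨
      suc m ×ᵣ 1# + - (suc n ×ᵣ 1#)   ∎

    +-homo : ∀ i j → ⟦ i ℤ.+ j ⟧ℤ ≈ ⟦ i ⟧ℤ + ⟦ j ⟧ℤ
    +-homo (ℤ.+ m) (ℤ.+ n) = ×-homo-+ 1# m n
    +-homo (ℤ.+ m) -[1+ n ] = ⊖-homo m (suc n)
    +-homo -[1+ m ] (ℤ.+ n) = trans (⊖-homo n (suc m)) (+-comm _ _)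
    +-homo -[1+ m ] -[1+ n ] = begin
      - (suc (suc (m ℕ.+ n)) ×ᵣ 1#)      ≡⟨ ≡.cong (λ k → - (suc k ×ᵣ 1#)) (ℕₚ.+-suc m n) ⟨
      - ((suc m ℕ.+ suc n) ×ᵣ 1#)        ≈⟨ -‿cong (×-homo-+ 1# (suc m) (suc n)) ⟩
      - (suc m ×ᵣ 1# + suc n ×ᵣ 1#)      ≈⟨ ⁻¹-∙-comm _ _ ⟨
      - (suc m ×ᵣ 1#) + - (suc n ×ᵣ 1#)  ∎

    +◃-homo : ∀ n → ⟦ Sign.+ ◃ n ⟧ℤ ≈ n ×ᵣ 1#
    +◃-homo zero = refl
    +◃-homo (suc n) = refl

    -◃-homo : ∀ n → ⟦ Sign.- ◃ n ⟧ℤ ≈ - (n ×ᵣ 1#)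
    -◃-homo zero = sym -0#≈0#
    -◃-homo (suc n) = refl

    *-homo : ∀ i j → ⟦ i ℤ.* j ⟧ℤ ≈ ⟦ i ⟧ℤ * ⟦ j ⟧ℤ
    *-homo (ℤ.+ m) (ℤ.+ n) = trans (+◃-homo (m ℕ.* n)) (×1-homo-* m n)
    *-homo (ℤ.+ m) -[1+ n ] = begin
      ⟦ Sign.- ◃ (m ℕ.* suc n) ⟧ℤ        ≈⟨ -◃-homo (m ℕ.* suc n) ⟩
      - ((m ℕ.* suc n) ×ᵣ 1#)            ≈⟨ -‿cong (×1-homo-* m (suc n)) ⟩
      - (m ×ᵣ 1# * suc n ×ᵣ 1#)          ≈⟨ -‿distribʳ-* _ _ ⟩
      m ×ᵣ 1# * - (suc n ×ᵣ 1#)          ∎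
    *-homo -[1+ m ] (ℤ.+ n) = begin
      ⟦ Sign.- ◃ (suc m ℕ.* n) ⟧ℤ        ≈⟨ -◃-homo (suc m ℕ.* n) ⟩
      - ((suc m ℕ.* n) ×ᵣ 1#)            ≈⟨ -‿cong (×1-homo-* (suc m) n) ⟩
      - (suc m ×ᵣ 1# * n ×ᵣ 1#)          ≈⟨ -‿distribˡ-* _ _ ⟩
      - (suc m ×ᵣ 1#) * n ×ᵣ 1#          ∎
    *-homo -[1+ m ] -[1+ n ] = begin
      ⟦ Sign.+ ◃ (suc m ℕ.* suc n) ⟧ℤ    ≈⟨ +◃-homo (suc m ℕ.* suc n) ⟩
      (suc m ℕ.* suc n) ×ᵣ 1#            ≈⟨ ×1-homo-* (suc m) (suc n) ⟩
      x * y                              ≈⟨ -‿involutive _ ⟨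
      - - (x * y)                        ≈⟨ -‿cong (-‿distribˡ-* _ _) ⟩
      - (- x * y)                        ≈⟨ -‿distribʳ-* _ _ ⟩
      - x * - y                          ∎
      where x = suc m ×ᵣ 1#
            y = suc n ×ᵣ 1#

    ℤ⟶R : ℤ.+-*-rawRing -Raw-AlmostCommutative⟶ fromCommutativeRing R
    ℤ⟶R = record
      { ⟦_⟧ = ⟦_⟧ℤ ; +-homo = +-homo ; *-homo = *-homo ; -‿homo = neg-homo
      ; 0-homo = refl ; 1-homo = +-identityʳ 1# }

    ℤ-equal? : ∀ i j → Maybe (⟦ i ⟧ℤ ≈ ⟦ j ⟧ℤ)
    ℤ-equal? i j with i ℤ.≟ j
    ... | yes ≡.refl = just refl
    ... | no _ = nothing

  open import Algebra.Solver.Ring ℤ.+-*-rawRing (fromCommutativeRing R) ℤ⟶R ℤ-equal? public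

module VectorAlgebra {q : ℕ} (F : FiniteField q) where
  open FiniteField F
  open Geometry F

  fieldRing : CommutativeRing _ _
  fieldRing = record { isCommutativeRing = isCommutativeRing }

  open CommutativeRing fieldRing using (*-identityʳ; +-identityʳ)
  open IntegerCoefficientSolver fieldRing
    using (solve; _:=_; _:+_; _:*_; :-_; con; Polynomial)
  open ≡ using (refl; sym; trans; cong)
  open ≡.≡-Reasoning

  difference-to-sum : ∀ {a b c} → a + - b ≡ c → a ≡ b + c
  difference-to-sum {a} {b} a-b≡c = begin
    a              ≡⟨ solve 2 (λ a b → a := b :+ (a :+ :- b)) refl a b ⟩
    b + (a + - b)  ≡⟨ cong (b +_) a-b≡c ⟩
    b + _          ∎

  difference-zero : ∀ {a b} → a + - b ≡ 0# → a ≡ b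
  difference-zero a-b≡0 = trans (difference-to-sum a-b≡0) (+-identityʳ _)

  pt-≡ : ∀ {a b c a′ b′ c′} → a ≡ a′ → b ≡ b′ → c ≡ c′ → ⟨ a , b , c ⟩ ≡ ⟨ a′ , b′ , c′ ⟩
  pt-≡ refl refl refl = refl

  _≟ₚ_ : (u v : Pt) → Dec (u ≡ v)
  ⟨ a , b , c ⟩ ≟ₚ ⟨ a′ , b′ , c′ ⟩ with a ≟ a′ | b ≟ b′ | c ≟ c′
  ... | yes refl | yes refl | yes refl = yes refl
  ... | no a≢a′  | _        | _        = no (λ e → a≢a′ (cong x₁ e))
  ... | yes _    | no b≢b′  | _        = no (λ e → b≢b′ (cong x₂ e))
  ... | yes _    | yes _    | no c≢c′  = no (λ e → c≢c′ (cong x₃ e))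

  collinear? : ∀ a b c → Dec (Collinear a b c)
  collinear? a b c = ((b ⊖ a) ×ᵥ (c ⊖ a)) ≟ₚ 𝟎

  ⊖-to-⊕ : ∀ {r p v} → r ⊖ p ≡ v → r ≡ p ⊕ v
  ⊖-to-⊕ refl = pt-≡ (difference-to-sum refl) (difference-to-sum refl) (difference-to-sum refl)

  proportional-coordinate : ∀ {dk ι wj wk dj} →
    dk * ι ≡ 1# → dk * wj ≡ dj * wk → wj ≡ (wk * ι) * dj
  proportional-coordinate {dk} {ι} {wj} {wk} {dj} inv minor = begin
    wj              ≡⟨ sym (*-identityʳ wj) ⟩
    wj * 1#         ≡⟨ cong (wj *_) (sym inv) ⟩
    wj * (dk * ι)   ≡⟨ solve 3 (λ wj dk ι → wj :* (dk :* ι) := (dk :* wj) :* ι) refl wj dk ι ⟩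
    (dk * wj) * ι   ≡⟨ cong (_* ι) minor ⟩
    (dj * wk) * ι   ≡⟨ solve 3 (λ dj wk ι → (dj :* wk) :* ι := (wk :* ι) :* dj) refl dj wk ι ⟩
    (wk * ι) * dj   ∎

  parallel-from-minors : ∀ {d₁ d₂ d₃ w₁ w₂ w₃} → NonZero ⟨ d₁ , d₂ , d₃ ⟩ →
    d₂ * w₃ ≡ d₃ * w₂ → d₃ * w₁ ≡ d₁ * w₃ → d₁ * w₂ ≡ d₂ * w₁ →
    Σ Carrier λ t → ⟨ w₁ , w₂ , w₃ ⟩ ≡ t · ⟨ d₁ , d₂ , d₃ ⟩
  parallel-from-minors {d₁} {d₂} {d₃} {w₁} {w₂} {w₃} d≢0 m₁ m₂ m₃
    with d₁ ≟ 0# | d₂ ≟ 0# | d₃ ≟ 0#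
  ... | no d₁≢0 | _ | _ =
    let (ι , inv) = inverse d₁ d₁≢0 in
    w₁ * ι , pt-≡ (proportional-coordinate inv refl) (proportional-coordinate inv m₃)
                  (proportional-coordinate inv (sym m₂))
  ... | yes _ | no d₂≢0 | _ =
    let (ι , inv) = inverse d₂ d₂≢0 in
    w₂ * ι , pt-≡ (proportional-coordinate inv (sym m₃)) (proportional-coordinate inv refl)
                  (proportional-coordinate inv m₁)
  ... | yes _ | yes _ | no d₃≢0 =
    let (ι , inv) = inverse d₃ d₃≢0 in
    w₃ * ι , pt-≡ (proportional-coordinate inv m₂) (proportional-coordinate inv (sym m₁))
                  (proportional-coordinate inv refl)
  ... | yes refl | yes refl | yes refl = ⊥-elim (d≢0 refl)

  parallel-if-cross-zero : ∀ d w → NonZero d → d ×ᵥ w ≡ 𝟎 → Σ Carrier λ t → w ≡ t · d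
  parallel-if-cross-zero ⟨ _ , _ , _ ⟩ ⟨ _ , _ , _ ⟩ d≢0 d×w≡0 =
    parallel-from-minors d≢0 (difference-zero (cong x₁ d×w≡0))
      (difference-zero (cong x₂ d×w≡0)) (difference-zero (cong x₃ d×w≡0))

  -- Syntactic counterparts of the vector operations, so that identities
  -- between vector expressions can be handed to the ring solver.
  Vec₃ : ℕ → Set
  Vec₃ k = Polynomial k × Polynomial k × Polynomial k

  _∙ₑ_ : ∀ {k} → Vec₃ k → Vec₃ k → Polynomial k
  (a , b , c) ∙ₑ (d , e , f) = a :* d :+ b :* e :+ c :* f

  _×ₑ_ : ∀ {k} → Vec₃ k → Vec₃ k → Vec₃ k
  (a , b , c) ×ₑ (d , e , f) =
    (b :* f :+ :- (c :* e)) , (c :* d :+ :- (a :* f)) , (a :* e :+ :- (b :* d))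

  _⊖ₑ_ : ∀ {k} → Vec₃ k → Vec₃ k → Vec₃ k
  (a , b , c) ⊖ₑ (d , e , f) = (a :+ :- d) , (b :+ :- e) , (c :+ :- f)

  _⊕ₑ_ : ∀ {k} → Vec₃ k → Vec₃ k → Vec₃ k
  (a , b , c) ⊕ₑ (d , e , f) = (a :+ d) , (b :+ e) , (c :+ f)

  _·ₑ_ : ∀ {k} → Polynomial k → Vec₃ k → Vec₃ k
  t ·ₑ (a , b , c) = (t :* a) , (t :* b) , (t :* c)

  ∙-zeroʳ : ∀ v → v ∙ 𝟎 ≡ 0#
  ∙-zeroʳ ⟨ a , b , c ⟩ =
    solve 3 (λ a b c → a :* zero′ :+ b :* zero′ :+ c :* zero′ := zero′) refl a b c
    where zero′ : Polynomial 3
          zero′ = con (ℤ.+ 0)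

  ∙-along-line : ∀ n p t d → n ∙ (p ⊕ (t · d)) ≡ n ∙ p + t * (n ∙ d)
  ∙-along-line ⟨ n₁ , n₂ , n₃ ⟩ ⟨ p₁ , p₂ , p₃ ⟩ t ⟨ d₁ , d₂ , d₃ ⟩ =
    solve 10 (λ n₁ n₂ n₃ p₁ p₂ p₃ t d₁ d₂ d₃ →
      let n = (n₁ , n₂ , n₃) ; p = (p₁ , p₂ , p₃) ; d = (d₁ , d₂ , d₃)
      in n ∙ₑ (p ⊕ₑ (t ·ₑ d)) := n ∙ₑ p :+ t :* (n ∙ₑ d))
      refl n₁ n₂ n₃ p₁ p₂ p₃ t d₁ d₂ d₃

  triple-product-on-parallel-lines : ∀ d p r y t s →
    let N = d ×ᵥ (r ⊖ p) ; A = p ⊕ (t · d) ; B = r ⊕ (s · d)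
    in (N ∙ y) + - (N ∙ p) ≡ d ∙ ((B ⊖ A) ×ᵥ (y ⊖ A))
  triple-product-on-parallel-lines
    ⟨ d₁ , d₂ , d₃ ⟩ ⟨ p₁ , p₂ , p₃ ⟩ ⟨ r₁ , r₂ , r₃ ⟩ ⟨ y₁ , y₂ , y₃ ⟩ t s =
    solve 14 (λ d₁ d₂ d₃ p₁ p₂ p₃ r₁ r₂ r₃ y₁ y₂ y₃ t s →
      let d = (d₁ , d₂ , d₃) ; p = (p₁ , p₂ , p₃) ; r = (r₁ , r₂ , r₃) ; y = (y₁ , y₂ , y₃)
          N = d ×ₑ (r ⊖ₑ p) ; A = p ⊕ₑ (t ·ₑ d) ; B = r ⊕ₑ (s ·ₑ d)
      in N ∙ₑ y :+ :- (N ∙ₑ p) := d ∙ₑ ((B ⊖ₑ A) ×ₑ (y ⊖ₑ A)))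
      refl d₁ d₂ d₃ p₁ p₂ p₃ r₁ r₂ r₃ y₁ y₂ y₃ t s

module ParallelLines {q : ℕ} (F : FiniteField q) where
  open FiniteField F
  open Geometry F
  open VectorAlgebra F
  open CommutativeRing fieldRing using (*-identityʳ)
  open IntegerCoefficientSolver fieldRing using (solve; _:=_; _:+_; _:*_; :-_)
  open ≡ using (refl; cong)
  open ≡.≡-Reasoning

  -- normal vector of the plane containing the parallel lines {p + t·d} and {r + t·d}
  spanNormal : Pt → Pt → Pt → Pt
  spanNormal d p r = d ×ᵥ (r ⊖ p)

  InPlaneOfLines : Pt → Pt → Pt → Pt → Set
  InPlaneOfLines d p r = InPlane (spanNormal d p r) (spanNormal d p r ∙ p)

  spanNormal-nonzero : ∀ {d p r} → NonZero d → ¬ OnAffineLine p d r → NonZero (spanNormal d p r)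
  spanNormal-nonzero {d} {p} {r} d≢0 r∉f N≡0 =
    let (t , r-p≡td) = parallel-if-cross-zero d (r ⊖ p) d≢0 N≡0
    in r∉f (t , ⊖-to-⊕ r-p≡td)

  line-meets-plane : ∀ n d → ¬ OnLineAtInfinity d n → ∀ c p →
    Σ Carrier λ t → InPlane n c (p ⊕ (t · d))
  line-meets-plane n d n∙d≢0 c p =
    let (ι , inv) = inverse (n ∙ d) n∙d≢0
        t = (c + - (n ∙ p)) * ι
    in t , (begin
      n ∙ (p ⊕ (t · d))               ≡⟨ ∙-along-line n p t d ⟩
      n ∙ p + t * (n ∙ d)             ≡⟨ solve 4 (λ np c ι nd → np :+ ((c :+ :- np) :* ι) :* nd
                                                               := np :+ (c :+ :- np) :* (nd :* ι))
                                                refl (n ∙ p) c ι (n ∙ d) ⟩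
      n ∙ p + (c + - (n ∙ p)) * ((n ∙ d) * ι)  ≡⟨ cong (λ u → n ∙ p + (c + - (n ∙ p)) * u) inv ⟩
      n ∙ p + (c + - (n ∙ p)) * 1#   ≡⟨ cong (n ∙ p +_) (*-identityʳ _) ⟩
      n ∙ p + (c + - (n ∙ p))        ≡⟨ solve 2 (λ np c → np :+ (c :+ :- np) := c) refl (n ∙ p) c ⟩
      c                               ∎)

  undetermined⇒collinear : ∀ {U n c a b e} → ¬ Determined U n →
    a ∈ U → b ∈ U → e ∈ U → InPlane n c a → InPlane n c b → InPlane n c e →
    Collinear a b e
  undetermined⇒collinear {c = c} {a} {b} {e} undet a∈U b∈U e∈U a∈π b∈π e∈π
    with collinear? a b e
  ... | yes col = col
  ... | no ¬col = ⊥-elim (undet (c , a , b , e , (a∈U , b∈U , e∈U) , (a∈π , b∈π , e∈π) , ¬col))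

  collinear⇒in-plane-of-lines : ∀ d p r y t s →
    Collinear (p ⊕ (t · d)) (r ⊕ (s · d)) y → InPlaneOfLines d p r y
  collinear⇒in-plane-of-lines d p r y t s col = difference-zero (begin
    N ∙ y + - (N ∙ p)               ≡⟨ triple-product-on-parallel-lines d p r y t s ⟩
    d ∙ ((B ⊖ A) ×ᵥ (y ⊖ A))        ≡⟨ cong (d ∙_) col ⟩
    d ∙ 𝟎                           ≡⟨ ∙-zeroʳ d ⟩
    0#                              ∎)
    where N = spanNormal d p r
          A = p ⊕ (t · d)
          B = r ⊕ (s · d)

  -- If n is undetermined and d is not on n, then U lies in the plane of f
  -- and g.  The plane through y ∈ U with line at infinity n
  -- meets f and g in points of U, which are collinear with y.
  undetermined⇒U-in-plane-of-lines : ∀ {U n d p r} →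
    LineIn p d U → LineIn r d U → ¬ Determined U n → ¬ OnLineAtInfinity d n →
    ∀ y → y ∈ U → InPlaneOfLines d p r y
  undetermined⇒U-in-plane-of-lines {n = n} {d} {p} {r} f⊆U g⊆U undet n∙d≢0 y y∈U =
    let (t , A∈π) = line-meets-plane n d n∙d≢0 (n ∙ y) p
        (s , B∈π) = line-meets-plane n d n∙d≢0 (n ∙ y) r
    in collinear⇒in-plane-of-lines d p r y t s
         (undetermined⇒collinear undet (f⊆U t) (g⊆U s) y∈U A∈π B∈π refl)

  undetermined-lines-through-direction : ∀ {U d p r} → ¬ InSomePlane U → NonZero d →
    LineIn p d U → LineIn r d U → ¬ OnAffineLine p d r →
    ∀ n → ¬ Determined U n → OnLineAtInfinity d n
  undetermined-lines-through-direction {d = d} {p} {r} nonplanar d≢0 f⊆U g⊆U r∉f n undet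
    with (n ∙ d) ≟ 0#
  ... | yes n∙d≡0 = n∙d≡0
  ... | no n∙d≢0 = ⊥-elim (nonplanar (spanNormal d p r , spanNormal d p r ∙ p ,
                      spanNormal-nonzero d≢0 r∉f ,
                      undetermined⇒U-in-plane-of-lines f⊆U g⊆U undet n∙d≢0))

open import Data.Nat using (_*_)

-- Corollary 3.
corollary3 : {q : ℕ} (F : FiniteField q) →
    let open Geometry F in
    (U : List Pt) → Unique U → length U ≡ q * q → ¬ InSomePlane U →
    -- more than two lines of H∞ are not determined by U
    (Σ Pt λ n₁ → Σ Pt λ n₂ → Σ Pt λ n₃ →
       (NonZero n₁ × NonZero n₂ × NonZero n₃) ×
       (DistinctLines n₁ n₂ × DistinctLines n₁ n₃ × DistinctLines n₂ n₃) ×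
       (¬ Determined U n₁ × ¬ Determined U n₂ × ¬ Determined U n₃)) →
    -- ℓ₁ is one of them
    (ℓ₁ : Pt) → NonZero ℓ₁ → ¬ Determined U ℓ₁ →
    -- f = {p + t d}, g = {r + t d} distinct parallel affine lines in U, ideal point on ℓ₁
    (d p r : Pt) → NonZero d → LineIn p d U → LineIn r d U →
    ¬ OnAffineLine p d r → OnLineAtInfinity d ℓ₁ →
    -- every non-determined line of H∞ passes through the ideal point of f and g
    (∀ n → NonZero n → ¬ Determined U n → OnLineAtInfinity d n)
corollary3 F U _ _ nonplanar _ _ _ _ d p r d≢0 f⊆U g⊆U r∉f _ n _ undet =
  undetermined-lines-through-direction nonplanar d≢0 f⊆U g⊆U r∉f n undet
  where open ParallelLines F
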